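{- Let $n\in\mathbb{N}$, let $F$ be uniform over the set of all functions $[n]\to[n]$, and let $W$ be an event (jointly distributed with $F$) with $\Pr[W]\ge p$, where $p>0$. Let $Y$ be uniform over $[n]$ and independent of $F$ and $W$. Then for every sets $\mathcal{S}_1,\dots,\mathcal{S}_n\subseteq[n]$ of size $c$ and every $\gamma\in[0,\tfrac12]$, $$\Pr[Y\in F(\mathcal{S}_Y)\mid W]\le\gamma+2^{\,2\lceil\gamma n\rceil\log(1/\gamma)+\lceil\gamma n\rceil\log(c/n)+\log(1/p)}.$$
   Context: Logarithms base 2; $F(\mathcal{S})=\{F(x):x\in\mathcal{S}\}$.
   Formalization: The parameters γ and p are rational, and the conditional probability of the event W given each value of F takes values in the rationals. -}

module Defs where

open import Data.Bool using (Bool; true; false; _∧_; if_then_else_)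
open import Data.Nat as ℕ using (ℕ; zero; suc)
open import Data.Integer as ℤ using (ℤ; +_)
open import Data.Fin using (Fin; zero; suc)
open import Data.Fin.Subset using (Subset; _∈_)
open import Data.Fin.Subset.Properties using (_∈?_)
open import Data.Fin.Properties using () renaming (_≟_ to _≟ᶠ_)
open import Data.List using (List; []; _∷_; map; concatMap; foldr; allFin)
open import Data.Bool.ListAction using (any)
open import Data.Rational as ℚ using (ℚ; 0ℚ; 1ℚ; _+_; _*_; _÷_; _/_; _<_; _≤_; ceiling; >-nonZero)
open import Data.Rational.Properties using (<-≤-trans)
open import Relation.Nullary.Decidable using (does)

-- [n] is modelled as Fin n.
-- All functions [n] → [m], as an explicit list (the finite sample space of F).
allFns : ∀ n m → List (Fin n → Fin m)
allFns zero    m = (λ ()) ∷ []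
allFns (suc n) m =
  concatMap (λ a → map (λ f → λ { zero → a ; (suc i) → f i }) (allFns n m)) (allFin m)

Σℚ : ∀ {A : Set} → List A → (A → ℚ) → ℚ
Σℚ xs g = foldr (λ x acc → g x + acc) 0ℚ xs

_^ℚ_ : ℚ → ℕ → ℚ
q ^ℚ zero  = 1ℚ
q ^ℚ suc k = q * (q ^ℚ k)

𝟙 : Bool → ℚ
𝟙 true  = 1ℚ
𝟙 false = 0ℚ

inImage : ∀ {n} → (Fin n → Fin n) → Subset n → Fin n → Bool
inImage {n} f S y = any (λ x → does (x ∈? S) ∧ does (f x ≟ᶠ y)) (allFin n)

-- Probability space: F uniform on [n]→[n]; W an event jointly distributed with F,
-- given by its conditional probability w f = Pr[W | F = f] ∈ [0,1];
-- Y uniform on [n], independent of (F, W).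
-- Pr[F = f, W, Y = y] = (1/n^n) · w f · (1/n).

IsCondProb : ∀ {n} → ((Fin n → Fin n) → ℚ) → Set
IsCondProb {n} w = ∀ f → (0ℚ ≤ w f) Data.Product.× (w f ≤ 1ℚ)
  where import Data.Product

module _ (n : ℕ) .{{_ : ℕ.NonZero n}} where

  private
    instance
      nⁿ≢0 : ℕ.NonZero (n ℕ.^ n)
      nⁿ≢0 = Data.Nat.Properties.m^n≢0 n n
        where import Data.Nat.Properties

  PrW : ((Fin n → Fin n) → ℚ) → ℚ
  PrW w = Σℚ (allFns n n) (λ f → ((+ 1) / (n ℕ.^ n)) * w f)

  PrHitW : ((Fin n → Fin n) → ℚ) → (Fin n → Subset n) → ℚ
  PrHitW w S = Σℚ (allFns n n) (λ f → Σℚ (allFin n) (λ y →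
                 ((+ 1) / (n ℕ.^ n)) * w f * ((+ 1) / n) * 𝟙 (inImage f (S y) y)))

  PrHit∣W : (w : (Fin n → Fin n) → ℚ) → (S : Fin n → Subset n) → 0ℚ < PrW w → ℚ
  PrHit∣W w S pos = _÷_ (PrHitW w S) (PrW w) {{>-nonZero pos}}

  -- the bound  γ + 2^{2k log(1/γ) + k log(c/n) + log(1/p)}, k = ⌈γ n⌉,
  -- written as  γ + (1/γ)^{2k} · (c/n)^k · (1/p)   (valid for γ, p > 0)
  bound : (c : ℕ) (γ p : ℚ) → 0ℚ < γ → 0ℚ < p → ℚ
  bound c γ p γ>0 p>0 =
    γ + (ℚ.1/_ γ {{>-nonZero γ>0}} ^ℚ (2 ℕ.* k))
          * ((ℤ.+ c / n) ^ℚ k)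
          * ℚ.1/_ p {{>-nonZero p>0}}
    where k = ℤ.∣ ⌈ γ * ((+ n) / 1) ⌉ ∣

  PrW-pos : (w : (Fin n → Fin n) → ℚ) (p : ℚ) → 0ℚ < p → p ≤ PrW w → 0ℚ < PrW w
  PrW-pos w p p>0 p≤ = <-≤-trans p>0 p≤

-- Write X(f) for the number of y with y ∈ f(S_y), and k = ⌈γn⌉. Given F = f, the event
-- Y ∈ F(S_Y) has probability X(f)/n, which is at most γ unless X(f) ≥ k; hence
-- Pr[Y ∈ F(S_Y) ∧ W] ≤ γ·Pr[W] + Pr[X(F) ≥ k]. If X(f) ≥ k then some k points y are hit, each
-- through one of the c candidates x ∈ S_y, and prescribing f at k points has probability n^(-k);
-- this union bound gives Pr[X(F) ≥ k] ≤ C(n,k)·(c/n)^k. Finally C(n,k) ≤ γ^(-2k): if 2k ≤ n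
-- because C(n,k)·k^(2k) ≤ n^(2k) and γ ≤ k/n, and otherwise because C(n,k) ≤ 2^n ≤ 2^(2k) and
-- γ ≤ 1/2. Dividing by Pr[W] ≥ p gives the bound.

module Submission where

open import Algebra.Bundles using (CommutativeSemiring; CommutativeRing)

module ListSum {c ℓ} (R : CommutativeSemiring c ℓ) where
  open import Data.Fin using (Fin; zero; suc)
  open import Data.List using (List; []; _∷_; _++_; map; concatMap; foldr; allFin; tabulate)
  open import Data.List.Properties using (map-tabulate)
  open import Data.Nat using (suc)
  open import Function using (_∘_; id)
  open import Relation.Binary.PropositionalEquality as ≡ using (_≡_; cong)
  open import Defs using (allFns)

  open CommutativeSemiring R hiding (zero)
  open import Algebra.Properties.CommutativeSemigroup +-commutativeSemigroup using (interchange)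
  open import Relation.Binary.Reasoning.Setoid setoid

  private variable
    A B : Set

  ∑ : List A → (A → Carrier) → Carrier
  ∑ xs g = foldr (λ x acc → g x + acc) 0# xs

  ∑-cong : ∀ (xs : List A) {g h} → (∀ x → g x ≈ h x) → ∑ xs g ≈ ∑ xs h
  ∑-cong []       g≈h = refl
  ∑-cong (x ∷ xs) g≈h = +-cong (g≈h x) (∑-cong xs g≈h)

  ∑-zero : ∀ (xs : List A) → ∑ xs (λ _ → 0#) ≈ 0#
  ∑-zero []       = refl
  ∑-zero (x ∷ xs) = trans (+-identityˡ _) (∑-zero xs)

  ∑-++ : ∀ (xs ys : List A) g → ∑ (xs ++ ys) g ≈ ∑ xs g + ∑ ys g
  ∑-++ []       ys g = sym (+-identityˡ _)
  ∑-++ (x ∷ xs) ys g = trans (+-congˡ (∑-++ xs ys g)) (sym (+-assoc _ _ _))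

  ∑-map : ∀ (f : A → B) xs g → ∑ (map f xs) g ≡ ∑ xs (g ∘ f)
  ∑-map f []       g = ≡.refl
  ∑-map f (x ∷ xs) g = cong (g (f x) +_) (∑-map f xs g)

  ∑-concatMap : ∀ (f : A → List B) xs g → ∑ (concatMap f xs) g ≈ ∑ xs (λ x → ∑ (f x) g)
  ∑-concatMap f []       g = refl
  ∑-concatMap f (x ∷ xs) g = trans (∑-++ (f x) _ g) (+-congˡ (∑-concatMap f xs g))

  ∑-distrib-+ : ∀ (xs : List A) g h → ∑ xs (λ x → g x + h x) ≈ ∑ xs g + ∑ xs h
  ∑-distrib-+ []       g h = sym (+-identityˡ 0#)
  ∑-distrib-+ (x ∷ xs) g h = trans (+-congˡ (∑-distrib-+ xs g h)) (interchange _ _ _ _)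

  *-distribˡ-∑ : ∀ (xs : List A) a g → a * ∑ xs g ≈ ∑ xs (λ x → a * g x)
  *-distribˡ-∑ []       a g = zeroʳ a
  *-distribˡ-∑ (x ∷ xs) a g = trans (distribˡ a _ _) (+-congˡ (*-distribˡ-∑ xs a g))

  *-distribʳ-∑ : ∀ (xs : List A) a g → ∑ xs g * a ≈ ∑ xs (λ x → g x * a)
  *-distribʳ-∑ xs a g = begin
    ∑ xs g * a            ≈⟨ *-comm _ a ⟩
    a * ∑ xs g            ≈⟨ *-distribˡ-∑ xs a g ⟩
    ∑ xs (λ x → a * g x)  ≈⟨ ∑-cong xs (λ x → *-comm a (g x)) ⟩
    ∑ xs (λ x → g x * a)  ∎

  ∑-comm : ∀ (xs : List A) (ys : List B) (g : A → B → Carrier) →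
           ∑ xs (λ x → ∑ ys (g x)) ≈ ∑ ys (λ y → ∑ xs (λ x → g x y))
  ∑-comm []       ys g = sym (∑-zero ys)
  ∑-comm (x ∷ xs) ys g = begin
    ∑ ys (g x) + ∑ xs (λ x′ → ∑ ys (g x′))             ≈⟨ +-congˡ (∑-comm xs ys g) ⟩
    ∑ ys (g x) + ∑ ys (λ y → ∑ xs (λ x′ → g x′ y))     ≈⟨ ∑-distrib-+ ys (g x) _ ⟨
    ∑ ys (λ y → g x y + ∑ xs (λ x′ → g x′ y))          ∎

  ∑-allFin-suc : ∀ n g → ∑ (allFin (suc n)) g ≡ g zero + ∑ (allFin n) (g ∘ suc)
  ∑-allFin-suc n g = cong (g zero +_)
    (≡.trans (cong (λ ys → ∑ ys g) (≡.sym (map-tabulate id suc))) (∑-map suc (allFin n) g))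

  ∑-allFns-suc : ∀ d m (G : Fin m → (Fin d → Fin m) → Carrier) →
                 ∑ (allFns (suc d) m) (λ h → G (h zero) (h ∘ suc)) ≈ ∑ (allFin m) (λ a → ∑ (allFns d m) (G a))
  ∑-allFns-suc d m G = trans (∑-concatMap _ (allFin m) _)
    (∑-cong (allFin m) (λ a → reflexive (∑-map _ (allFns d m) _)))

module Counting where

  open import Data.Bool using (Bool; true; false; _∧_)
  open import Data.Bool.ListAction using (any)
  open import Data.Fin using (Fin; zero; suc)
  open import Data.Fin.Properties using (_≟_)
  open import Data.Fin.Subset using (Subset; ∣_∣; inside; outside)
  open import Data.Fin.Subset.Properties using (_∈?_)
  open import Data.List using (List; []; _∷_; _++_; map; allFin; length)
  open import Data.List.Properties using (length-++; length-tabulate; map-++; ++-assoc)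
  open import Data.List.Relation.Binary.Sublist.Propositional using (_⊆_; []; _∷_; _∷ʳ_; ⊆-refl)
  open import Data.List.Relation.Binary.Sublist.Propositional.Properties using (All-resp-⊆; ++⁺; ++⁺ʳ)
  open import Data.List.Relation.Unary.All using ([]; _∷_)
  open import Data.List.Relation.Unary.AllPairs using ([]; _∷_)
  open import Data.List.Relation.Unary.Unique.Propositional using (Unique)
  open import Data.List.Relation.Unary.Unique.Propositional.Properties using (allFin⁺)
  open import Data.Nat using (ℕ; zero; suc; _+_; _*_; _^_; _≤_; z≤n; s≤s)
  open import Data.Nat.Properties hiding (_≟_)
  open import Data.Product using (_×_; _,_; proj₂)
  open import Data.Vec using ([]; _∷_)
  open import Function using (_∘_; id)
  open import Relation.Nullary using (Dec; does; yes; no; contradiction)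
  open import Relation.Binary.PropositionalEquality
  open import Defs using (allFns; inImage)
  open import Data.Nat.Combinatorics using (_C_; nCk+nC[k+1]≡[n+1]C[k+1])
  open import Data.Nat.Solver using (module +-*-Solver)
  open import Algebra.Properties.CommutativeSemigroup *-commutativeSemigroup using (x∙yz≈y∙xz; interchange)

  open ListSum +-*-commutativeSemiring
  open +-*-Solver

  private variable
    A : Set
    d m : ℕ

  𝟙ℕ : Bool → ℕ
  𝟙ℕ true  = 1
  𝟙ℕ false = 0

  𝟙ℕ≤1 : ∀ b → 𝟙ℕ b ≤ 1
  𝟙ℕ≤1 true  = ≤-refl
  𝟙ℕ≤1 false = z≤n

  𝟙ℕ-∧ : ∀ a b → 𝟙ℕ (a ∧ b) ≡ 𝟙ℕ a * 𝟙ℕ b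
  𝟙ℕ-∧ true  b = sym (*-identityˡ (𝟙ℕ b))
  𝟙ℕ-∧ false b = refl

  ∑-mono-≤ : ∀ (xs : List A) {g h} → (∀ x → g x ≤ h x) → ∑ xs g ≤ ∑ xs h
  ∑-mono-≤ []       g≤h = z≤n
  ∑-mono-≤ (x ∷ xs) g≤h = +-mono-≤ (g≤h x) (∑-mono-≤ xs g≤h)

  ∑-≤-length : ∀ (xs : List A) {g} → (∀ x → g x ≤ 1) → ∑ xs g ≤ length xs
  ∑-≤-length []       g≤1 = z≤n
  ∑-≤-length (x ∷ xs) g≤1 = +-mono-≤ (g≤1 x) (∑-≤-length xs g≤1)

  𝟙ℕ-any : ∀ (p : A → Bool) xs → 𝟙ℕ (any p xs) ≤ ∑ xs (𝟙ℕ ∘ p)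
  𝟙ℕ-any p []       = z≤n
  𝟙ℕ-any p (x ∷ xs) with p x
  ... | true  = s≤s z≤n
  ... | false = 𝟙ℕ-any p xs

  ∑-𝟙ℕ-≟ : ∀ {m} (y : Fin m) → ∑ (allFin m) (λ a → 𝟙ℕ (does (a ≟ y))) ≡ 1
  ∑-𝟙ℕ-≟ {suc m} y = trans (∑-allFin-suc m (λ a → 𝟙ℕ (does (a ≟ y)))) (head+tail y)
    where
    head+tail : ∀ y → 𝟙ℕ (does (zero ≟ y)) + ∑ (allFin m) (λ a → 𝟙ℕ (does (suc a ≟ y))) ≡ 1
    head+tail zero    = cong suc (∑-zero (allFin m))
    head+tail (suc y) = ∑-𝟙ℕ-≟ y

  ∑-𝟙ℕ-∈ : ∀ {n} (S : Subset n) → ∑ (allFin n) (λ x → 𝟙ℕ (does (x ∈? S))) ≡ ∣ S ∣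
  ∑-𝟙ℕ-∈ []            = refl
  ∑-𝟙ℕ-∈ {suc n} (b ∷ S) = trans (∑-allFin-suc n (λ x → 𝟙ℕ (does (x ∈? (b ∷ S))))) (head+tail b)
    where
    head+tail : ∀ b → 𝟙ℕ (does (zero ∈? (b ∷ S))) + ∑ (allFin n) (λ x → 𝟙ℕ (does (x ∈? S)))
                      ≡ ∣ b ∷ S ∣
    head+tail inside  = cong suc (∑-𝟙ℕ-∈ S)
    head+tail outside = ∑-𝟙ℕ-∈ S

  values : List (Fin d × Fin m) → List (Fin m)
  values = map proj₂

  -- A list of pairs (x , y) stands for the constraints f x ≡ y.
  fits : List (Fin d × Fin m) → (Fin d → Fin m) → ℕ
  fits []             f = 1
  fits ((x , y) ∷ cs) f = 𝟙ℕ (does (f x ≟ y)) * fits cs f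

  fits-++ : ∀ (cs ds : List (Fin d × Fin m)) f → fits (cs ++ ds) f ≡ fits cs f * fits ds f
  fits-++ []             ds f = sym (+-identityʳ (fits ds f))
  fits-++ ((x , y) ∷ cs) ds f = trans (cong (e *_) (fits-++ cs ds f)) (sym (*-assoc e (fits cs f) (fits ds f)))
    where e = 𝟙ℕ (does (f x ≟ y))

  allEqual : List (Fin m) → Fin m → ℕ
  allEqual []       a = 1
  allEqual (y ∷ ys) a = 𝟙ℕ (does (a ≟ y)) * allEqual ys a

  Unique-resp-⊆ : {xs ys : List A} → xs ⊆ ys → Unique ys → Unique xs
  Unique-resp-⊆ []          []         = []
  Unique-resp-⊆ (y ∷ʳ xs⊆ys) (_ ∷ u)   = Unique-resp-⊆ xs⊆ys u
  Unique-resp-⊆ (refl ∷ xs⊆ys) (y∉ ∷ u) = All-resp-⊆ xs⊆ys y∉ ∷ Unique-resp-⊆ xs⊆ys u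

  ∑-allEqual : (ys : List (Fin m)) → Unique ys → ∑ (allFin m) (allEqual ys) * m ^ length ys ≤ m
  ∑-allEqual {m} [] _ = begin
    ∑ (allFin m) (λ _ → 1) * 1  ≡⟨ *-identityʳ _ ⟩
    ∑ (allFin m) (λ _ → 1)      ≤⟨ ∑-≤-length (allFin m) (λ _ → ≤-refl) ⟩
    length (allFin m)           ≡⟨ length-tabulate id ⟩
    m                           ∎
    where open ≤-Reasoning
  ∑-allEqual {m} (y ∷ []) _ = ≤-reflexive (begin
    ∑ (allFin m) (λ a → 𝟙ℕ (does (a ≟ y)) * 1) * (m * 1)
                                        ≡⟨ cong₂ _*_ (∑-cong (allFin m) (λ a → *-identityʳ _)) (*-identityʳ m) ⟩
    ∑ (allFin m) (λ a → 𝟙ℕ (does (a ≟ y))) * m            ≡⟨ cong (_* m) (∑-𝟙ℕ-≟ y) ⟩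
    1 * m                                                  ≡⟨ *-identityˡ m ⟩
    m                                                      ∎)
    where open ≡-Reasoning
  ∑-allEqual {m} (y ∷ y′ ∷ ys) ((y≢y′ ∷ _) ∷ _) = ≤-trans (≤-reflexive (begin
    ∑ (allFin m) (allEqual (y ∷ y′ ∷ ys)) * M  ≡⟨ cong (_* M) (∑-cong (allFin m) vanishes) ⟩
    ∑ (allFin m) (λ _ → 0) * M                 ≡⟨ cong (_* M) (∑-zero (allFin m)) ⟩
    0                                          ∎)) z≤n
    where
    open ≡-Reasoning
    M = m ^ length (y ∷ y′ ∷ ys)
    vanishes : ∀ a → allEqual (y ∷ y′ ∷ ys) a ≡ 0
    vanishes a with a ≟ y | a ≟ y′
    ... | no _     | _       = refl
    ... | yes _    | no _    = *-zeroʳ 1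
    ... | yes refl | yes a≡y′ = contradiction a≡y′ y≢y′

  atZero : List (Fin (suc d) × Fin m) → List (Fin m)
  atZero []                 = []
  atZero ((zero  , y) ∷ cs) = y ∷ atZero cs
  atZero ((suc _ , _) ∷ cs) = atZero cs

  atSuc : List (Fin (suc d) × Fin m) → List (Fin d × Fin m)
  atSuc []                 = []
  atSuc ((zero  , _) ∷ cs) = atSuc cs
  atSuc ((suc x , y) ∷ cs) = (x , y) ∷ atSuc cs

  fits-split : ∀ (cs : List (Fin (suc d) × Fin m)) h →
               fits cs h ≡ allEqual (atZero cs) (h zero) * fits (atSuc cs) (h ∘ suc)
  fits-split []                 h = refl
  fits-split ((zero  , y) ∷ cs) h = trans (cong (e *_) (fits-split cs h))
                                          (sym (*-assoc e (allEqual (atZero cs) (h zero)) (fits (atSuc cs) (h ∘ suc))))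
    where e = 𝟙ℕ (does (h zero ≟ y))
  fits-split ((suc x , y) ∷ cs) h = trans (cong (e *_) (fits-split cs h))
                                          (x∙yz≈y∙xz e (allEqual (atZero cs) (h zero)) (fits (atSuc cs) (h ∘ suc)))
    where e = 𝟙ℕ (does (h (suc x) ≟ y))

  length-split : ∀ (cs : List (Fin (suc d) × Fin m)) → length cs ≡ length (atZero cs) + length (atSuc cs)
  length-split []                 = refl
  length-split ((zero  , _) ∷ cs) = cong suc (length-split cs)
  length-split ((suc _ , _) ∷ cs) = trans (cong suc (length-split cs)) (sym (+-suc _ _))

  atZero-⊆ : ∀ (cs : List (Fin (suc d) × Fin m)) → atZero cs ⊆ values cs
  atZero-⊆ []                 = []
  atZero-⊆ ((zero  , y) ∷ cs) = refl ∷ atZero-⊆ cs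
  atZero-⊆ ((suc _ , y) ∷ cs) = y ∷ʳ atZero-⊆ cs

  atSuc-⊆ : ∀ (cs : List (Fin (suc d) × Fin m)) → values (atSuc cs) ⊆ values cs
  atSuc-⊆ []                 = []
  atSuc-⊆ ((zero  , y) ∷ cs) = y ∷ʳ atSuc-⊆ cs
  atSuc-⊆ ((suc _ , y) ∷ cs) = refl ∷ atSuc-⊆ cs

  -- Distinct values force distinct points, and each constraint at a fresh point divides the
  -- number of functions by m.
  ∑-fits : ∀ d m (cs : List (Fin d × Fin m)) → Unique (values cs) →
           ∑ (allFns d m) (fits cs) * m ^ length cs ≤ m ^ d
  ∑-fits zero    m []             _ = ≤-refl
  ∑-fits (suc d) m cs u = begin
    ∑ (allFns (suc d) m) (fits cs) * m ^ length cs
      ≡⟨ cong₂ _*_ sum-split (cong (m ^_) (length-split cs)) ⟩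
    (Z * F) * m ^ (length zs + length cs′)
      ≡⟨ cong ((Z * F) *_) (^-distribˡ-+-* m (length zs) (length cs′)) ⟩
    (Z * F) * (m ^ length zs * m ^ length cs′)
      ≡⟨ interchange Z F (m ^ length zs) (m ^ length cs′) ⟩
    (Z * m ^ length zs) * (F * m ^ length cs′)
      ≤⟨ *-mono-≤ (∑-allEqual zs (Unique-resp-⊆ (atZero-⊆ cs) u))
                  (∑-fits d m cs′ (Unique-resp-⊆ (atSuc-⊆ cs) u)) ⟩
    m * m ^ d ∎
    where
    open ≤-Reasoning
    zs  = atZero cs
    cs′ = atSuc cs
    Z F : ℕ
    Z = ∑ (allFin m) (allEqual zs)
    F = ∑ (allFns d m) (fits cs′)
    sum-split : ∑ (allFns (suc d) m) (fits cs) ≡ Z * F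
    sum-split = begin-equality
      ∑ (allFns (suc d) m) (fits cs)
        ≡⟨ ∑-cong (allFns (suc d) m) (fits-split cs) ⟩
      ∑ (allFns (suc d) m) (λ h → allEqual zs (h zero) * fits cs′ (h ∘ suc))
        ≡⟨ ∑-allFns-suc d m (λ a g → allEqual zs a * fits cs′ g) ⟩
      ∑ (allFin m) (λ a → ∑ (allFns d m) (λ g → allEqual zs a * fits cs′ g))
        ≡⟨ ∑-cong (allFin m) (λ a → sym (*-distribˡ-∑ (allFns d m) (allEqual zs a) (fits cs′))) ⟩
      ∑ (allFin m) (λ a → allEqual zs a * F)
        ≡⟨ sym (*-distribʳ-∑ (allFin m) F (allEqual zs)) ⟩
      Z * F ∎

  -- The j-th elementary symmetric polynomial of a 0/1 sequence: its number of j-subsets of 1s.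
  esym : ℕ → List Bool → ℕ
  esym zero    bs       = 1
  esym (suc j) []       = 0
  esym (suc j) (b ∷ bs) = 𝟙ℕ b * esym j bs + esym (suc j) bs

  1≤esym : ∀ j bs → j ≤ ∑ bs 𝟙ℕ → 1 ≤ esym j bs
  1≤esym zero    bs           _         = ≤-refl
  1≤esym (suc j) (true ∷ bs)  (s≤s j≤) =
    ≤-trans (1≤esym j bs j≤) (≤-trans (≤-reflexive (sym (+-identityʳ _))) (m≤m+n _ _))
  1≤esym (suc j) (false ∷ bs) j≤       = 1≤esym (suc j) bs j≤

  module Hits (n : ℕ) (S : Fin n → Subset n) where

    hit : Fin n → (Fin n → Fin n) → Bool
    hit y f = inImage f (S y) y

    hits : List (Fin n) → (Fin n → Fin n) → List Bool
    hits L f = map (λ y → hit y f) L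

    𝟙ℕ-hit≤ : ∀ y f →
              𝟙ℕ (hit y f) ≤ ∑ (allFin n) (λ x → 𝟙ℕ (does (x ∈? S y)) * 𝟙ℕ (does (f x ≟ y)))
    𝟙ℕ-hit≤ y f = ≤-trans (𝟙ℕ-any _ (allFin n))
      (≤-reflexive (∑-cong (allFin n) (λ x → 𝟙ℕ-∧ (does (x ∈? S y)) (does (f x ≟ y)))))

    ∑-fits-hit : ∀ cs y (E : (Fin n → Fin n) → ℕ) e r →
                 (∀ x → ∑ (allFns n n) (λ f → fits (cs ++ (x , y) ∷ []) f * E f) * e ≤ r) →
                 ∑ (allFns n n) (λ f → fits cs f * (𝟙ℕ (hit y f) * E f)) * e ≤ ∣ S y ∣ * r
    ∑-fits-hit cs y E e r bound = begin
      ∑ FN (λ f → fits cs f * (𝟙ℕ (hit y f) * E f)) * e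
        ≤⟨ *-monoˡ-≤ e (∑-mono-≤ FN pointwise) ⟩
      ∑ FN (λ f → ∑ X (λ x → inS x * F x f)) * e
        ≡⟨ cong (_* e) (∑-comm FN X (λ f x → inS x * F x f)) ⟩
      ∑ X (λ x → ∑ FN (λ f → inS x * F x f)) * e
        ≡⟨ cong (_* e) (∑-cong X (λ x → sym (*-distribˡ-∑ FN (inS x) (F x)))) ⟩
      ∑ X (λ x → inS x * ∑ FN (F x)) * e
        ≡⟨ *-distribʳ-∑ X e (λ x → inS x * ∑ FN (F x)) ⟩
      ∑ X (λ x → inS x * ∑ FN (F x) * e)
        ≡⟨ ∑-cong X (λ x → *-assoc (inS x) (∑ FN (F x)) e) ⟩
      ∑ X (λ x → inS x * (∑ FN (F x) * e))
        ≤⟨ ∑-mono-≤ X (λ x → *-monoʳ-≤ (inS x) (bound x)) ⟩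
      ∑ X (λ x → inS x * r)
        ≡⟨ sym (*-distribʳ-∑ X r inS) ⟩
      ∑ X inS * r
        ≡⟨ cong (_* r) (∑-𝟙ℕ-∈ (S y)) ⟩
      ∣ S y ∣ * r ∎
      where
      open ≤-Reasoning
      FN = allFns n n
      X  = allFin n
      inS : Fin n → ℕ
      inS x = 𝟙ℕ (does (x ∈? S y))
      F : Fin n → (Fin n → Fin n) → ℕ
      F x f = fits (cs ++ (x , y) ∷ []) f * E f
      pointwise : ∀ f → fits cs f * (𝟙ℕ (hit y f) * E f) ≤ ∑ X (λ x → inS x * F x f)
      pointwise f = begin
        fits cs f * (𝟙ℕ (hit y f) * E f)
          ≤⟨ *-monoʳ-≤ (fits cs f) (*-monoˡ-≤ (E f) (𝟙ℕ-hit≤ y f)) ⟩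
        fits cs f * (∑ X (λ x → inS x * eq x) * E f)
          ≡⟨ cong (fits cs f *_) (*-distribʳ-∑ X (E f) (λ x → inS x * eq x)) ⟩
        fits cs f * ∑ X (λ x → inS x * eq x * E f)
          ≡⟨ *-distribˡ-∑ X (fits cs f) (λ x → inS x * eq x * E f) ⟩
        ∑ X (λ x → fits cs f * (inS x * eq x * E f))
          ≡⟨ ∑-cong X (λ x → rearrange x) ⟩
        ∑ X (λ x → inS x * F x f) ∎
        where
        eq : Fin n → ℕ
        eq x = 𝟙ℕ (does (f x ≟ y))
        rearrange : ∀ x → fits cs f * (inS x * eq x * E f) ≡ inS x * F x f
        rearrange x = begin-equality
          fits cs f * (inS x * eq x * E f)
            ≡⟨ solve 4 (λ q a b e → q :* (a :* b :* e) := a :* (q :* (b :* con 1) :* e)) refl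
                       (fits cs f) (inS x) (eq x) (E f) ⟩
          inS x * (fits cs f * fits ((x , y) ∷ []) f * E f)
            ≡⟨ cong (λ z → inS x * (z * E f)) (sym (fits-++ cs ((x , y) ∷ []) f)) ⟩
          inS x * F x f ∎

    module _ {c} (|S|≤c : ∀ y → ∣ S y ∣ ≤ c) where

      -- Union bound over the j-subsets of L that are hit: each point y already selected is
      -- recorded in cs together with its chosen preimage x ∈ S y.
      ∑-fits-esym : ∀ cs L j → Unique (values cs ++ L) →
                    ∑ (allFns n n) (λ f → fits cs f * esym j (hits L f)) * n ^ (length cs + j)
                      ≤ (length L C j) * c ^ j * n ^ n
      ∑-fits-esym cs L zero u = begin
        ∑ FN (λ f → fits cs f * 1) * n ^ (length cs + 0)
          ≡⟨ cong₂ _*_ (∑-cong FN (λ f → *-identityʳ (fits cs f))) (cong (n ^_) (+-identityʳ (length cs))) ⟩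
        ∑ FN (fits cs) * n ^ length cs
          ≤⟨ ∑-fits n n cs (Unique-resp-⊆ (++⁺ʳ L ⊆-refl) u) ⟩
        n ^ n
          ≡⟨ sym (*-identityˡ (n ^ n)) ⟩
        (length L C 0) * c ^ 0 * n ^ n ∎
        where open ≤-Reasoning; FN = allFns n n
      ∑-fits-esym cs [] (suc j) u = ≤-trans (≤-reflexive (begin-equality
        ∑ FN (λ f → fits cs f * 0) * N  ≡⟨ cong (_* N) (∑-cong FN (λ f → *-zeroʳ (fits cs f))) ⟩
        ∑ FN (λ _ → 0) * N              ≡⟨ cong (_* N) (∑-zero FN) ⟩
        0 ∎)) z≤n
        where open ≤-Reasoning; FN = allFns n n; N = n ^ (length cs + suc j)
      ∑-fits-esym cs (y ∷ L) (suc j) u = begin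
        ∑ FN (λ f → fits cs f * (𝟙ℕ (hit y f) * esym j (hits L f) + esym (suc j) (hits L f))) * N
          ≡⟨ cong (_* N) (trans (∑-cong FN (λ f → *-distribˡ-+ (fits cs f) _ _)) (∑-distrib-+ FN with-y without-y)) ⟩
        (∑ FN with-y + ∑ FN without-y) * N
          ≡⟨ *-distribʳ-+ N (∑ FN with-y) (∑ FN without-y) ⟩
        ∑ FN with-y * N + ∑ FN without-y * N
          ≤⟨ +-mono-≤ (≤-trans (∑-fits-hit cs y (λ f → esym j (hits L f)) N R extend) (*-monoˡ-≤ R (|S|≤c y)))
                      (∑-fits-esym cs L (suc j) (Unique-resp-⊆ (++⁺ ⊆-refl (y ∷ʳ ⊆-refl)) u)) ⟩
        c * R + (length L C suc j) * c ^ suc j * n ^ n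
          ≡⟨ solve 5 (λ c a b x z → c :* (a :* x :* z) :+ b :* (c :* x) :* z := (a :+ b) :* (c :* x) :* z) refl
                     c (length L C j) (length L C suc j) (c ^ j) (n ^ n) ⟩
        (length L C j + length L C suc j) * c ^ suc j * n ^ n
          ≡⟨ cong (λ z → z * c ^ suc j * n ^ n) (nCk+nC[k+1]≡[n+1]C[k+1] (length L) j) ⟩
        (suc (length L) C suc j) * c ^ suc j * n ^ n ∎
        where
        open ≤-Reasoning
        FN = allFns n n
        N  = n ^ (length cs + suc j)
        R  = (length L C j) * c ^ j * n ^ n
        with-y without-y : (Fin n → Fin n) → ℕ
        with-y    f = fits cs f * (𝟙ℕ (hit y f) * esym j (hits L f))
        without-y f = fits cs f * esym (suc j) (hits L f)
        extend : ∀ x → ∑ FN (λ f → fits (cs ++ (x , y) ∷ []) f * esym j (hits L f)) * N ≤ R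
        extend x = subst (λ e → ∑ FN (λ f → fits cs′ f * esym j (hits L f)) * n ^ e ≤ R) length-cs′
                     (∑-fits-esym cs′ L j (subst Unique values-cs′ u))
          where
          cs′ = cs ++ (x , y) ∷ []
          length-cs′ : length cs′ + j ≡ length cs + suc j
          length-cs′ = trans (cong (_+ j) (trans (length-++ cs) (+-comm (length cs) 1))) (sym (+-suc (length cs) j))
          values-cs′ : values cs ++ y ∷ L ≡ values cs′ ++ L
          values-cs′ = trans (sym (++-assoc (values cs) (y ∷ []) L)) (cong (_++ L) (sym (map-++ proj₂ cs ((x , y) ∷ []))))

    hitCount : (Fin n → Fin n) → ℕ
    hitCount f = ∑ (allFin n) (λ y → 𝟙ℕ (hit y f))

    hitCount≤n : ∀ f → hitCount f ≤ n
    hitCount≤n f = ≤-trans (∑-≤-length (allFin n) (λ y → 𝟙ℕ≤1 (hit y f))) (≤-reflexive (length-tabulate id))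

    atLeast : ℕ → ℕ
    atLeast k = ∑ (allFns n n) (λ f → 𝟙ℕ (does (k ≤? hitCount f)))

    atLeast-bound : ∀ {c} → (∀ y → ∣ S y ∣ ≤ c) → ∀ k → atLeast k * n ^ k ≤ (n C k) * c ^ k * n ^ n
    atLeast-bound {c} |S|≤c k = begin
      atLeast k * n ^ k
        ≤⟨ *-monoˡ-≤ (n ^ k) (∑-mono-≤ FN (λ f → atLeast≤esym f (k ≤? hitCount f))) ⟩
      ∑ FN (λ f → fits [] f * esym k (hits (allFin n) f)) * n ^ (0 + k)
        ≤⟨ ∑-fits-esym |S|≤c [] (allFin n) k (allFin⁺ n) ⟩
      (length (allFin n) C k) * c ^ k * n ^ n
        ≡⟨ cong (λ m → (m C k) * c ^ k * n ^ n) (length-tabulate id) ⟩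
      (n C k) * c ^ k * n ^ n ∎
      where
      open ≤-Reasoning
      FN = allFns n n
      atLeast≤esym : ∀ f → (k≤? : Dec (k ≤ hitCount f)) → 𝟙ℕ (does k≤?) ≤ 1 * esym k (hits (allFin n) f)
      atLeast≤esym f (no _)  = z≤n
      atLeast≤esym f (yes k≤) =
        ≤-trans (1≤esym k (hits (allFin n) f) (≤-trans k≤ (≤-reflexive (sym (∑-map _ (allFin n) 𝟙ℕ)))))
                (≤-reflexive (sym (*-identityˡ _)))

module Binomial where

  open import Data.Nat using (zero; suc; _+_; _*_; _^_; _∸_; _≤_; z≤n)
  open import Data.Nat.Properties
  open import Data.Nat.Combinatorics using (_C_; nC1≡n; nCk+nC[k+1]≡[n+1]C[k+1])
  open import Data.Nat.Combinatorics.Specification using (k>n⇒nCk≡0)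
  open import Data.Nat.Solver using (module +-*-Solver)
  open import Relation.Binary.PropositionalEquality
  open import Relation.Nullary using (yes; no)
  open +-*-Solver

  nCk≤2^n : ∀ n k → n C k ≤ 2 ^ n
  nCk≤2^n n       zero    = m^n>0 2 n
  nCk≤2^n zero    (suc k) = z≤n
  nCk≤2^n (suc n) (suc k) = begin
    suc n C suc k        ≡⟨ nCk+nC[k+1]≡[n+1]C[k+1] n k ⟨
    n C k + n C suc k    ≤⟨ +-mono-≤ (nCk≤2^n n k) (nCk≤2^n n (suc k)) ⟩
    2 ^ n + 2 ^ n        ≡⟨ cong (2 ^ n +_) (+-identityʳ (2 ^ n)) ⟨
    2 ^ suc n            ∎
    where open ≤-Reasoning

  nCk*[m+[n∸m]]≡nCk*n : ∀ n m k → m ≤ k → (n C k) * (m + (n ∸ m)) ≡ (n C k) * n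
  nCk*[m+[n∸m]]≡nCk*n n m k m≤k with m ≤? n
  ... | yes m≤n = cong ((n C k) *_) (m+[n∸m]≡n m≤n)
  ... | no  m≰n rewrite k>n⇒nCk≡0 {n} {k} (<-≤-trans (≰⇒> m≰n) m≤k) = refl

  nCk*[n∸k]≡nC[k+1]*[k+1] : ∀ n k → (n C k) * (n ∸ k) ≡ (n C suc k) * suc k
  nCk*[n∸k]≡nC[k+1]*[k+1] zero    zero    = refl
  nCk*[n∸k]≡nC[k+1]*[k+1] zero    (suc k) = refl
  nCk*[n∸k]≡nC[k+1]*[k+1] (suc n) zero    = trans (*-identityˡ (suc n)) (sym (trans (*-identityʳ _) (nC1≡n (suc n))))
  nCk*[n∸k]≡nC[k+1]*[k+1] (suc n) (suc k) = trans lhs (sym rhs)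
    where
    open ≡-Reasoning
    lhs : (suc n C suc k) * (n ∸ k) ≡ (n C suc k) * suc n
    lhs = begin
      (suc n C suc k) * (n ∸ k)                   ≡⟨ cong (_* (n ∸ k)) (nCk+nC[k+1]≡[n+1]C[k+1] n k) ⟨
      (n C k + n C suc k) * (n ∸ k)               ≡⟨ *-distribʳ-+ (n ∸ k) (n C k) (n C suc k) ⟩
      (n C k) * (n ∸ k) + (n C suc k) * (n ∸ k)   ≡⟨ cong (_+ (n C suc k) * (n ∸ k)) (nCk*[n∸k]≡nC[k+1]*[k+1] n k) ⟩
      (n C suc k) * suc k + (n C suc k) * (n ∸ k) ≡⟨ *-distribˡ-+ (n C suc k) (suc k) (n ∸ k) ⟨
      (n C suc k) * suc (k + (n ∸ k))             ≡⟨ *-suc (n C suc k) (k + (n ∸ k)) ⟩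
      n C suc k + (n C suc k) * (k + (n ∸ k))     ≡⟨ cong (n C suc k +_) (nCk*[m+[n∸m]]≡nCk*n n k (suc k) (n≤1+n k)) ⟩
      n C suc k + (n C suc k) * n                 ≡⟨ *-suc (n C suc k) n ⟨
      (n C suc k) * suc n                         ∎
    rhs : (suc n C suc (suc k)) * suc (suc k) ≡ (n C suc k) * suc n
    rhs = begin
      (suc n C suc (suc k)) * suc (suc k)                 ≡⟨ cong (_* suc (suc k)) (nCk+nC[k+1]≡[n+1]C[k+1] n (suc k)) ⟨
      (n C suc k + n C suc (suc k)) * suc (suc k)         ≡⟨ *-distribʳ-+ (suc (suc k)) (n C suc k) (n C suc (suc k)) ⟩
      (n C suc k) * suc (suc k) + (n C suc (suc k)) * suc (suc k)
                                                          ≡⟨ cong ((n C suc k) * suc (suc k) +_) (nCk*[n∸k]≡nC[k+1]*[k+1] n (suc k)) ⟨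
      (n C suc k) * suc (suc k) + (n C suc k) * (n ∸ suc k) ≡⟨ *-distribˡ-+ (n C suc k) (suc (suc k)) (n ∸ suc k) ⟨
      (n C suc k) * suc (suc k + (n ∸ suc k))             ≡⟨ *-suc (n C suc k) (suc k + (n ∸ suc k)) ⟩
      n C suc k + (n C suc k) * (suc k + (n ∸ suc k))     ≡⟨ cong (n C suc k +_) (nCk*[m+[n∸m]]≡nCk*n n (suc k) (suc k) ≤-refl) ⟩
      n C suc k + (n C suc k) * n                         ≡⟨ *-suc (n C suc k) n ⟨
      (n C suc k) * suc n                                 ∎

  [n+1]C[k+1]*[k+1]≡[n+1]*nCk : ∀ n k → (suc n C suc k) * suc k ≡ suc n * (n C k)
  [n+1]C[k+1]*[k+1]≡[n+1]*nCk n k = begin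
    (suc n C suc k) * suc k                   ≡⟨ cong (_* suc k) (nCk+nC[k+1]≡[n+1]C[k+1] n k) ⟨
    (n C k + n C suc k) * suc k               ≡⟨ *-distribʳ-+ (suc k) (n C k) (n C suc k) ⟩
    (n C k) * suc k + (n C suc k) * suc k     ≡⟨ cong ((n C k) * suc k +_) (nCk*[n∸k]≡nC[k+1]*[k+1] n k) ⟨
    (n C k) * suc k + (n C k) * (n ∸ k)       ≡⟨ *-distribˡ-+ (n C k) (suc k) (n ∸ k) ⟨
    (n C k) * suc (k + (n ∸ k))               ≡⟨ *-suc (n C k) (k + (n ∸ k)) ⟩
    n C k + (n C k) * (k + (n ∸ k))           ≡⟨ cong (n C k +_) (nCk*[m+[n∸m]]≡nCk*n n k k ≤-refl) ⟩
    n C k + (n C k) * n                       ≡⟨ *-suc (n C k) n ⟨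
    (n C k) * suc n                           ≡⟨ *-comm (n C k) (suc n) ⟩
    suc n * (n C k)                           ∎
    where open ≡-Reasoning

  [n+1]Ck*[n+1∸k]≡[n+1]*nCk : ∀ n k → (suc n C k) * (suc n ∸ k) ≡ suc n * (n C k)
  [n+1]Ck*[n+1∸k]≡[n+1]*nCk n k = trans (nCk*[n∸k]≡nC[k+1]*[k+1] (suc n) k) ([n+1]C[k+1]*[k+1]≡[n+1]*nCk n k)

  m^j*[m+j]≤m*[1+m]^j : ∀ m j → m ^ j * (m + j) ≤ m * suc m ^ j
  m^j*[m+j]≤m*[1+m]^j m zero    = ≤-reflexive (solve 1 (λ m → con 1 :* (m :+ con 0) := m :* con 1) refl m)
  m^j*[m+j]≤m*[1+m]^j m (suc j) = begin
    m * m ^ j * (m + suc j)     ≡⟨ solve 3 (λ m x j → m :* x :* (m :+ (con 1 :+ j)) := x :* (m :+ j) :* m :+ x :* m)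
                                           refl m (m ^ j) j ⟩
    m ^ j * (m + j) * m + m ^ j * m
                                ≤⟨ +-monoʳ-≤ (m ^ j * (m + j) * m) (*-monoʳ-≤ (m ^ j) (m≤m+n m j)) ⟩
    m ^ j * (m + j) * m + m ^ j * (m + j)
                                ≡⟨ solve 2 (λ x m → x :* m :+ x := x :* (con 1 :+ m)) refl (m ^ j * (m + j)) m ⟩
    m ^ j * (m + j) * suc m     ≤⟨ *-monoˡ-≤ (suc m) (m^j*[m+j]≤m*[1+m]^j m j) ⟩
    m * suc m ^ j * suc m       ≡⟨ solve 3 (λ m y s → m :* y :* s := m :* (s :* y)) refl m (suc m ^ j) (suc m) ⟩
    m * (suc m * suc m ^ j)     ∎
    where open ≤-Reasoning

  ^-distribʳ-* : ∀ m n o → (m * n) ^ o ≡ m ^ o * n ^ o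
  ^-distribʳ-* m n zero    = refl
  ^-distribʳ-* m n (suc o) = trans (cong (m * n *_) (^-distribʳ-* m n o))
    (solve 4 (λ m n x y → m :* n :* (x :* y) := m :* x :* (n :* y)) refl m n (m ^ o) (n ^ o))

  nCk*k^[2k]≤n^[2k] : ∀ n k → 2 * k ≤ n → (n C k) * k ^ (2 * k) ≤ n ^ (2 * k)
  nCk*k^[2k]≤n^[2k] n zero      _    = ≤-refl
  nCk*k^[2k]≤n^[2k] n k@(suc _) 2k≤n = subst₂ (λ n j → (n C k) * k ^ j ≤ n ^ j) n≡ j≡ (go (n ∸ 2 * k))
    where
    n≡ : k + (k + (n ∸ 2 * k)) ≡ n
    n≡ = trans (sym (+-assoc k k _)) (trans (cong (λ x → k + x + (n ∸ 2 * k)) (sym (+-identityʳ k))) (m+[n∸m]≡n 2k≤n))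
    j≡ : k + k ≡ 2 * k
    j≡ = cong (k +_) (sym (+-identityʳ k))
    j = k + k
    -- Induction on n ∸ 2k: from m to m + 1, C(m,k) grows by the factor (m+1)/(m+1-k), while m^(2k)
    -- grows by at least (m+2k)/m (Bernoulli); `quadratic` compares the two.
    go : ∀ t → ((k + (k + t)) C k) * k ^ j ≤ (k + (k + t)) ^ j
    go zero = begin
      ((k + (k + 0)) C k) * k ^ j  ≤⟨ *-monoˡ-≤ (k ^ j) (nCk≤2^n (k + (k + 0)) k) ⟩
      2 ^ (k + (k + 0)) * k ^ j    ≡⟨ cong (λ x → 2 ^ (k + x) * k ^ j) (+-identityʳ k) ⟩
      2 ^ j * k ^ j                ≡⟨ ^-distribʳ-* 2 k j ⟨
      (2 * k) ^ j                  ∎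
      where open ≤-Reasoning
    go (suc t) = subst (λ n → (n C k) * k ^ j ≤ n ^ j) suc-m≡ (*-cancelʳ-≤ _ _ (suc q) scaled)
      where
      open ≤-Reasoning
      q = k + t
      m = k + q
      suc-m≡ : suc m ≡ k + (k + suc t)
      suc-m≡ = sym (trans (cong (k +_) (+-suc k t)) (+-suc k q))
      suc-m∸k≡ : suc m ∸ k ≡ suc q
      suc-m∸k≡ = trans (cong (_∸ k) (sym (+-suc k q))) (m+n∸m≡n k (suc q))
      quadratic : m * suc m ≤ suc q * (m + j)
      quadratic = ≤-trans (m≤m+n (m * suc m) (k * t + k + k)) (≤-reflexive
        (solve 2 (λ k t → (k :+ (k :+ t)) :* (con 1 :+ (k :+ (k :+ t))) :+ (k :* t :+ k :+ k)
                          := (con 1 :+ (k :+ t)) :* ((k :+ (k :+ t)) :+ (k :+ k))) refl k t))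
      growth : suc m * m ^ j ≤ suc m ^ j * suc q
      growth = *-cancelˡ-≤ m (begin
        m * (suc m * m ^ j)      ≡⟨ *-assoc m (suc m) (m ^ j) ⟨
        m * suc m * m ^ j        ≤⟨ *-monoˡ-≤ (m ^ j) quadratic ⟩
        suc q * (m + j) * m ^ j  ≡⟨ solve 3 (λ a b c → a :* b :* c := a :* (c :* b)) refl (suc q) (m + j) (m ^ j) ⟩
        suc q * (m ^ j * (m + j)) ≤⟨ *-monoʳ-≤ (suc q) (m^j*[m+j]≤m*[1+m]^j m j) ⟩
        suc q * (m * suc m ^ j)  ≡⟨ solve 3 (λ a b c → a :* (b :* c) := b :* (c :* a)) refl (suc q) m (suc m ^ j) ⟩
        m * (suc m ^ j * suc q)  ∎)
      scaled : (suc m C k) * k ^ j * suc q ≤ suc m ^ j * suc q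
      scaled = begin
        (suc m C k) * k ^ j * suc q        ≡⟨ cong ((suc m C k) * k ^ j *_) suc-m∸k≡ ⟨
        (suc m C k) * k ^ j * (suc m ∸ k)  ≡⟨ solve 3 (λ a b c → a :* b :* c := a :* c :* b) refl (suc m C k) (k ^ j) (suc m ∸ k) ⟩
        (suc m C k) * (suc m ∸ k) * k ^ j  ≡⟨ cong (_* k ^ j) ([n+1]Ck*[n+1∸k]≡[n+1]*nCk m k) ⟩
        suc m * (m C k) * k ^ j            ≡⟨ *-assoc (suc m) (m C k) (k ^ j) ⟩
        suc m * ((m C k) * k ^ j)          ≤⟨ *-monoʳ-≤ (suc m) (go t) ⟩
        suc m * m ^ j                      ≤⟨ growth ⟩
        suc m ^ j * suc q                  ∎

module Rationals where

  open import Data.Integer as ℤ using (+_; -[1+_]; +[1+_]; ∣_∣)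
  import Data.Integer.Properties as ℤ
  open import Data.Integer.DivMod using (_/ℕ_)
  open import Data.Nat as ℕ using (ℕ; zero; suc; _∸_; NonZero)
  import Data.Nat.Properties as ℕ
  open import Data.Nat.DivMod using (m≡m%n+[m/n]*n; m%n<n)
  open import Data.Product using (_×_; _,_)
  open import Data.Rational as ℚ
    using (ℚ; mkℚ; 0ℚ; 1ℚ; _+_; _*_; _/_; _÷_; _≤_; _<_; 1/_; toℚᵘ; ceiling; >-nonZero; nonNegative; positive)
  open import Data.Rational.Properties
  open import Data.Rational.Solver using (module +-*-Solver)
  import Data.Rational.Unnormalised as ℚᵘ
  import Data.Rational.Unnormalised.Properties as ℚᵘ
  open import Relation.Binary.PropositionalEquality
  open import Relation.Nullary using (Dec; yes; no; ¬_; does)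
  open import Defs using (_^ℚ_; 𝟙)
  open +-*-Solver

  ι : ℕ → ℚ
  ι a = + a / 1

  toℚᵘ-/ : ∀ a d .{{_ : NonZero d}} → toℚᵘ (+ a / d) ℚᵘ.≃ ℚᵘ.mkℚᵘ (+ a) (ℕ.pred d)
  toℚᵘ-/ a (suc d) = toℚᵘ-fromℚᵘ (ℚᵘ.mkℚᵘ (+ a) d)

  /-mono-≤ : ∀ a b d e .{{_ : NonZero d}} .{{_ : NonZero e}} → a ℕ.* e ℕ.≤ b ℕ.* d → + a / d ≤ + b / e
  /-mono-≤ a b d@(suc _) e@(suc _) ae≤bd = toℚᵘ-cancel-≤
    (ℚᵘ.≤-respˡ-≃ (ℚᵘ.≃-sym (toℚᵘ-/ a d)) (ℚᵘ.≤-respʳ-≃ (ℚᵘ.≃-sym (toℚᵘ-/ b e))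
      (ℚᵘ.*≤* (subst₂ ℤ._≤_ (ℤ.pos-* a e) (ℤ.pos-* b d) (ℤ.+≤+ ae≤bd)))))

  /-* : ∀ a b d e .{{_ : NonZero d}} .{{_ : NonZero e}} →
        (+ a / d) * (+ b / e) ≡ (+ (a ℕ.* b) / (d ℕ.* e)) {{ℕ.m*n≢0 d e}}
  /-* a b d@(suc _) e@(suc _) = toℚᵘ-injective (ℚᵘ.≃-trans (toℚᵘ-homo-* (+ a / d) (+ b / e))
    (ℚᵘ.≃-trans (ℚᵘ.*-cong (toℚᵘ-/ a d) (toℚᵘ-/ b e))
      (ℚᵘ.≃-trans (ℚᵘ.*≡* (cong₂ ℤ._*_ (sym (ℤ.pos-* a b)) (ℤ.pos-* d e)))
        (ℚᵘ.≃-sym (toℚᵘ-/ (a ℕ.* b) (d ℕ.* e) {{ℕ.m*n≢0 d e}})))))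

  ι-+ : ∀ a b → ι (a ℕ.+ b) ≡ ι a + ι b
  ι-+ a b = toℚᵘ-injective (ℚᵘ.≃-trans (toℚᵘ-/ (a ℕ.+ b) 1)
    (ℚᵘ.≃-trans (ℚᵘ.*≡* (trans (ℤ.*-identityʳ _) (trans (ℤ.pos-+ a b)
        (sym (trans (ℤ.*-identityʳ _) (cong₂ ℤ._+_ (ℤ.*-identityʳ (+ a)) (ℤ.*-identityʳ (+ b))))))))
      (ℚᵘ.≃-sym (ℚᵘ.≃-trans (toℚᵘ-homo-+ (ι a) (ι b)) (ℚᵘ.+-cong (toℚᵘ-/ a 1) (toℚᵘ-/ b 1))))))

  /-cong-≡ : ∀ a b d e .{{_ : NonZero d}} .{{_ : NonZero e}} → a ℕ.* e ≡ b ℕ.* d → + a / d ≡ + b / e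
  /-cong-≡ a b d e ae≡bd =
    ≤-antisym (/-mono-≤ a b d e (ℕ.≤-reflexive ae≡bd)) (/-mono-≤ b a e d (ℕ.≤-reflexive (sym ae≡bd)))

  ι*/≡/ : ∀ a b d .{{_ : NonZero d}} → ι a * (+ b / d) ≡ + (a ℕ.* b) / d
  ι*/≡/ a b d = trans (/-* a b 1 d) (/-cong-≡ (a ℕ.* b) (a ℕ.* b) (1 ℕ.* d) d {{ℕ.m*n≢0 1 d}}
                                              (cong (a ℕ.* b ℕ.*_) (sym (ℕ.*-identityˡ d))))

  /≡ι*1/ : ∀ a d .{{_ : NonZero d}} → + a / d ≡ ι a * (+ 1 / d)
  /≡ι*1/ a d = sym (trans (ι*/≡/ a 1 d) (cong (λ x → + x / d) (ℕ.*-identityʳ a)))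

  /≤1 : ∀ {a} d .{{_ : NonZero d}} → a ℕ.≤ d → + a / d ≤ 1ℚ
  /≤1 {a} d a≤d = /-mono-≤ a 1 d 1
    (ℕ.≤-trans (ℕ.≤-reflexive (ℕ.*-identityʳ a)) (ℕ.≤-trans a≤d (ℕ.≤-reflexive (sym (ℕ.*-identityˡ d)))))

  ι*1/≡1 : ∀ d .{{_ : NonZero d}} → ι d * (+ 1 / d) ≡ 1ℚ
  ι*1/≡1 d = trans (sym (/≡ι*1/ d d)) (/-cong-≡ d 1 d 1 (ℕ.*-comm d 1))

  *-monoˡ-≤-0≤ : ∀ {r p q} → 0ℚ ≤ r → p ≤ q → r * p ≤ r * q
  *-monoˡ-≤-0≤ {r} 0≤r = *-monoˡ-≤-nonNeg r {{nonNegative 0≤r}}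

  *-monoʳ-≤-0≤ : ∀ {r p q} → 0ℚ ≤ r → p ≤ q → p * r ≤ q * r
  *-monoʳ-≤-0≤ {r} 0≤r = *-monoʳ-≤-nonNeg r {{nonNegative 0≤r}}

  0≤-* : ∀ {p q} → 0ℚ ≤ p → 0ℚ ≤ q → 0ℚ ≤ p * q
  0≤-* {p} {q} 0≤p 0≤q = ≤-trans (≤-reflexive (sym (*-zeroˡ q))) (*-monoʳ-≤-0≤ 0≤q 0≤p)

  0≤/ : ∀ a d .{{_ : NonZero d}} → 0ℚ ≤ + a / d
  0≤/ a d = nonNegative⁻¹ _ {{normalize-nonNeg a d}}

  0≤1/ : ∀ {p} (0<p : 0ℚ < p) → 0ℚ ≤ (1/ p) {{>-nonZero 0<p}}
  0≤1/ {p} 0<p = nonNegative⁻¹ _ {{pos⇒nonNeg ((1/ p) {{>-nonZero 0<p}}) {{1/pos⇒pos p {{positive 0<p}}}}}}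

  0≤^ℚ : ∀ {p} m → 0ℚ ≤ p → 0ℚ ≤ p ^ℚ m
  0≤^ℚ zero    0≤p = nonNegative⁻¹ 1ℚ
  0≤^ℚ (suc m) 0≤p = 0≤-* 0≤p (0≤^ℚ m 0≤p)

  ^ℚ-monoˡ-≤ : ∀ {p q} m → 0ℚ ≤ p → p ≤ q → p ^ℚ m ≤ q ^ℚ m
  ^ℚ-monoˡ-≤ zero    0≤p p≤q = ≤-refl
  ^ℚ-monoˡ-≤ (suc m) 0≤p p≤q =
    ≤-trans (*-monoʳ-≤-0≤ (0≤^ℚ m 0≤p) p≤q) (*-monoˡ-≤-0≤ (≤-trans 0≤p p≤q) (^ℚ-monoˡ-≤ m 0≤p p≤q))

  ^ℚ-distribʳ-* : ∀ p q m → (p * q) ^ℚ m ≡ p ^ℚ m * q ^ℚ m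
  ^ℚ-distribʳ-* p q zero    = refl
  ^ℚ-distribʳ-* p q (suc m) = trans (cong (p * q *_) (^ℚ-distribʳ-* p q m))
    (solve 4 (λ p q x y → p :* q :* (x :* y) := p :* x :* (q :* y)) refl p q (p ^ℚ m) (q ^ℚ m))

  1^ℚ : ∀ m → 1ℚ ^ℚ m ≡ 1ℚ
  1^ℚ zero    = refl
  1^ℚ (suc m) = trans (*-identityˡ (1ℚ ^ℚ m)) (1^ℚ m)

  /-^ℚ : ∀ a d m .{{_ : NonZero d}} → (+ a / d) ^ℚ m ≡ (+ (a ℕ.^ m) / (d ℕ.^ m)) {{ℕ.m^n≢0 d m}}
  /-^ℚ a d zero    = refl
  /-^ℚ a d (suc m) = trans (cong (+ a / d *_) (/-^ℚ a d m)) (/-* a (a ℕ.^ m) d (d ℕ.^ m))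
    where instance d^m≢0 = ℕ.m^n≢0 d m

  1/*ι≤1 : ∀ {a} d .{{_ : NonZero d}} → a ℕ.≤ d → (+ 1 / d) * ι a ≤ 1ℚ
  1/*ι≤1 {a} d a≤d = begin
    (+ 1 / d) * ι a ≡⟨ *-comm (+ 1 / d) (ι a) ⟩
    ι a * (+ 1 / d) ≡⟨ /≡ι*1/ a d ⟨
    + a / d         ≤⟨ /≤1 d a≤d ⟩
    1ℚ              ∎
    where open ≤-Reasoning

  1/*ι≤ : ∀ {a q} d .{{_ : NonZero d}} → ι a ≤ q * ι d → (+ 1 / d) * ι a ≤ q
  1/*ι≤ {a} {q} d a≤qd = begin
    (+ 1 / d) * ι a        ≤⟨ *-monoˡ-≤-0≤ (0≤/ 1 d) a≤qd ⟩
    (+ 1 / d) * (q * ι d)  ≡⟨ solve 3 (λ x q y → x :* (q :* y) := q :* (y :* x)) refl (+ 1 / d) q (ι d) ⟩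
    q * (ι d * (+ 1 / d))  ≡⟨ cong (q *_) (ι*1/≡1 d) ⟩
    q * 1ℚ                 ≡⟨ *-identityʳ q ⟩
    q                      ∎
    where open ≤-Reasoning

  *ι≤ι⇒≤/ : ∀ {a q} d .{{_ : NonZero d}} → q * ι d ≤ ι a → q ≤ + a / d
  *ι≤ι⇒≤/ {a} {q} d qd≤a = begin
    q                     ≡⟨ *-identityʳ q ⟨
    q * 1ℚ                ≡⟨ cong (q *_) (ι*1/≡1 d) ⟨
    q * (ι d * (+ 1 / d)) ≡⟨ *-assoc q (ι d) (+ 1 / d) ⟨
    q * ι d * (+ 1 / d)   ≤⟨ *-monoʳ-≤-0≤ (0≤/ 1 d) qd≤a ⟩
    ι a * (+ 1 / d)       ≡⟨ /≡ι*1/ a d ⟨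
    + a / d               ∎
    where open ≤-Reasoning


  *-≤-threshold : ∀ {a b x γ} {P : Set} (P? : Dec P) →
                  0ℚ ≤ a → a ≤ b → 0ℚ ≤ γ → x ≤ 1ℚ → (¬ P → x ≤ γ) →
                  a * x ≤ γ * a + b * 𝟙 (does P?)
  *-≤-threshold {a} {b} {x} {γ} (yes _) 0≤a a≤b 0≤γ x≤1 _ = begin
    a * x          ≤⟨ *-monoˡ-≤-0≤ 0≤a x≤1 ⟩
    a * 1ℚ         ≡⟨ *-identityʳ a ⟩
    a              ≤⟨ a≤b ⟩
    b              ≡⟨ +-identityˡ b ⟨
    0ℚ + b         ≤⟨ +-monoˡ-≤ b (0≤-* 0≤γ 0≤a) ⟩
    γ * a + b      ≡⟨ cong (_+_ (γ * a)) (*-identityʳ b) ⟨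
    γ * a + b * 1ℚ ∎
    where open ≤-Reasoning
  *-≤-threshold {a} {b} {x} {γ} (no ¬P) 0≤a _ _ _ x≤γ = begin
    a * x          ≤⟨ *-monoˡ-≤-0≤ 0≤a (x≤γ ¬P) ⟩
    a * γ          ≡⟨ *-comm a γ ⟩
    γ * a          ≡⟨ +-identityʳ (γ * a) ⟨
    γ * a + 0ℚ     ≡⟨ cong (_+_ (γ * a)) (*-zeroʳ b) ⟨
    γ * a + b * 0ℚ ∎
    where open ≤-Reasoning

  ι*^ℚ≤1 : ∀ B a b m .{{_ : NonZero b}} {γ} → B ℕ.* a ℕ.^ m ℕ.≤ b ℕ.^ m → 0ℚ ≤ γ → γ ≤ + a / b →
           ι B * γ ^ℚ m ≤ 1ℚ
  ι*^ℚ≤1 B a b m {γ} Ba^m≤b^m 0≤γ γ≤a/b = begin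
    ι B * γ ^ℚ m                  ≤⟨ *-monoˡ-≤-0≤ (0≤/ B 1) (^ℚ-monoˡ-≤ m 0≤γ γ≤a/b) ⟩
    ι B * (+ a / b) ^ℚ m          ≡⟨ cong (ι B *_) (/-^ℚ a b m) ⟩
    ι B * (+ (a ℕ.^ m) / b ℕ.^ m) ≡⟨ ι*/≡/ B (a ℕ.^ m) (b ℕ.^ m) ⟩
    + (B ℕ.* a ℕ.^ m) / b ℕ.^ m   ≤⟨ /≤1 (b ℕ.^ m) Ba^m≤b^m ⟩
    1ℚ                            ∎
    where
    open ≤-Reasoning
    instance b^m≢0 = ℕ.m^n≢0 b m

  ≤[1/γ]^ℚ : ∀ {x γ} m (0<γ : 0ℚ < γ) → x * γ ^ℚ m ≤ 1ℚ → x ≤ ((1/ γ) {{>-nonZero 0<γ}}) ^ℚ m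
  ≤[1/γ]^ℚ {x} {γ} m 0<γ xγ^m≤1 = begin
    x                             ≡⟨ *-identityʳ x ⟨
    x * 1ℚ                        ≡⟨ cong (x *_) (trans (cong (_^ℚ m) (*-inverseʳ γ)) (1^ℚ m)) ⟨
    x * (γ * 1/γ) ^ℚ m            ≡⟨ cong (x *_) (^ℚ-distribʳ-* γ 1/γ m) ⟩
    x * (γ ^ℚ m * 1/γ ^ℚ m)       ≡⟨ *-assoc x _ _ ⟨
    x * γ ^ℚ m * 1/γ ^ℚ m         ≤⟨ *-monoʳ-≤-0≤ (0≤^ℚ m (0≤1/ 0<γ)) xγ^m≤1 ⟩
    1ℚ * 1/γ ^ℚ m                 ≡⟨ *-identityˡ _ ⟩
    1/γ ^ℚ m                      ∎
    where
    open ≤-Reasoning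
    instance γ≢0 = >-nonZero 0<γ
    1/γ = 1/ γ

  ÷-≤ : ∀ {H P p γ T} (0<p : 0ℚ < p) (p≤P : p ≤ P) → 0ℚ ≤ T → H ≤ γ * P + T →
        (H ÷ P) {{>-nonZero (<-≤-trans 0<p p≤P)}} ≤ γ + T * (1/ p) {{>-nonZero 0<p}}
  ÷-≤ {H} {P} {p} {γ} {T} 0<p p≤P 0≤T H≤ = begin
    H * 1/P                         ≤⟨ *-monoʳ-≤-0≤ (0≤1/ 0<P) (≤-trans H≤ (+-monoʳ-≤ (γ * P) T≤)) ⟩
    (γ * P + T * 1/p * P) * 1/P     ≡⟨ cong (_* 1/P) (*-distribʳ-+ P γ (T * 1/p)) ⟨
    (γ + T * 1/p) * P * 1/P         ≡⟨ *-assoc (γ + T * 1/p) P 1/P ⟩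
    (γ + T * 1/p) * (P * 1/P)       ≡⟨ cong ((γ + T * 1/p) *_) (*-inverseʳ P) ⟩
    (γ + T * 1/p) * 1ℚ              ≡⟨ *-identityʳ _ ⟩
    γ + T * 1/p                     ∎
    where
    open ≤-Reasoning
    0<P = <-≤-trans 0<p p≤P
    instance P≢0 = >-nonZero 0<P
    instance p≢0 = >-nonZero 0<p
    1/P = 1/ P
    1/p = 1/ p
    T≤ : T ≤ T * 1/p * P
    T≤ = begin
      T                ≡⟨ trans (cong (T *_) (*-inverseʳ p)) (*-identityʳ T) ⟨
      T * (p * 1/p)    ≤⟨ *-monoˡ-≤-0≤ 0≤T (*-monoʳ-≤-0≤ (0≤1/ 0<p) p≤P) ⟩
      T * (P * 1/p)    ≡⟨ cong (T *_) (*-comm P 1/p) ⟩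
      T * (1/p * P)    ≡⟨ *-assoc T 1/p P ⟨
      T * 1/p * P      ∎

  -- k is ∣⌈(1+a)/(1+d)⌉∣ in the form computed by ceiling.
  ceil-div-bounds : ∀ a d → let k = ∣ ℤ.- (-[1+ a ] /ℕ suc d) ∣ in
                    suc a ℕ.≤ k ℕ.* suc d × (k ∸ 1) ℕ.* suc d ℕ.≤ suc a
  ceil-div-bounds a d with suc a ℕ.% suc d | m≡m%n+[m/n]*n (suc a) (suc d) | m%n<n (suc a) (suc d)
  ... | zero  | a≡ | _ rewrite ℤ.neg-involutive (+ (suc a ℕ./ suc d)) =
    ℕ.≤-reflexive a≡ ,
    ℕ.≤-trans (ℕ.*-monoˡ-≤ (suc d) (ℕ.m∸n≤m (suc a ℕ./ suc d) 1)) (ℕ.≤-reflexive (sym a≡))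
  ... | suc r | a≡ | r<d =
    ℕ.≤-trans (ℕ.≤-reflexive a≡) (ℕ.+-monoˡ-≤ (suc a ℕ./ suc d ℕ.* suc d) (ℕ.<⇒≤ r<d)) ,
    ℕ.≤-trans (ℕ.m≤n+m _ (suc r)) (ℕ.≤-reflexive (sym a≡))

  ceiling-bounds : ∀ q → 0ℚ < q → q ≤ ι ∣ ceiling q ∣ × ι (∣ ceiling q ∣ ∸ 1) ≤ q
  ceiling-bounds q@(mkℚ +[1+ a ] d _) _ rewrite cong ℤ.-_ (ℤ.*-identityˡ (-[1+ a ] /ℕ suc d))
    with ceil-div-bounds a d
  ... | a<k*d , [k-1]*d≤a =
    subst (_≤ ι k) (↥p/↧p≡p q)
          (/-mono-≤ (suc a) k (suc d) 1 (ℕ.≤-trans (ℕ.≤-reflexive (ℕ.*-identityʳ (suc a))) a<k*d)) ,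
    subst (ι (k ∸ 1) ≤_) (↥p/↧p≡p q)
          (/-mono-≤ (k ∸ 1) (suc a) 1 (suc d) (ℕ.≤-trans [k-1]*d≤a (ℕ.≤-reflexive (sym (ℕ.*-identityʳ (suc a))))))
    where k = ∣ ℤ.- (-[1+ a ] /ℕ suc d) ∣
  ceiling-bounds (mkℚ (+ zero)  _ _) (ℚ.*<* (ℤ.+<+ ()))
  ceiling-bounds (mkℚ -[1+ _ ]  _ _) (ℚ.*<* ())

open import Data.Bool using (Bool; true; false)
open import Data.Fin using (Fin)
open import Data.Fin.Subset using (Subset; ∣_∣)
open import Data.Integer as ℤ using (+_)
open import Data.List using (List; []; _∷_; allFin)
open import Data.Nat as ℕ using (ℕ; NonZero; _∸_)
import Data.Nat.Properties as ℕ
open import Data.Nat.Combinatorics using (_C_)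
open import Data.Product using (proj₁; proj₂)
open import Data.Rational using (ℚ; 0ℚ; 1ℚ; _+_; _*_; _/_; _≤_; _<_; 1/_; >-nonZero; ceiling; positive)
open import Data.Rational.Properties
open import Relation.Binary.PropositionalEquality
open import Relation.Nullary using (Dec; yes; no; ¬_; does)
open import Defs
open Counting using (𝟙ℕ; module Hits)
open Binomial using (nCk*k^[2k]≤n^[2k]; nCk≤2^n)
open Rationals

module ℕΣ = ListSum ℕ.+-*-commutativeSemiring
module ℚΣ = ListSum (CommutativeRing.commutativeSemiring +-*-commutativeRing)

∑-𝟙 : ∀ {A : Set} (xs : List A) (b : A → Bool) →
      ℚΣ.∑ xs (λ x → 𝟙 (b x)) ≡ ι (ℕΣ.∑ xs (λ x → 𝟙ℕ (b x)))
∑-𝟙 []       b = refl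
∑-𝟙 (x ∷ xs) b = trans (cong₂ _+_ (𝟙≡ι (b x)) (∑-𝟙 xs b)) (sym (ι-+ (𝟙ℕ (b x)) _))
  where
  𝟙≡ι : ∀ b → 𝟙 b ≡ ι (𝟙ℕ b)
  𝟙≡ι true  = refl
  𝟙≡ι false = refl

∑-mono-≤ : ∀ {A : Set} (xs : List A) {g h} → (∀ x → g x ≤ h x) → ℚΣ.∑ xs g ≤ ℚΣ.∑ xs h
∑-mono-≤ []       g≤h = ≤-refl
∑-mono-≤ (x ∷ xs) g≤h = +-mono-≤ (g≤h x) (∑-mono-≤ xs g≤h)

module _ (n : ℕ) .{{_ : NonZero n}} (S : Fin n → Subset n) where

  open Hits n S

  private instance
    nⁿ≢0 : NonZero (n ℕ.^ n)
    nⁿ≢0 = ℕ.m^n≢0 n n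

  PrHitW≤ : ∀ w → IsCondProb w → ∀ {γ} k → 0ℚ ≤ γ → ι (k ∸ 1) ≤ γ * ι n →
            PrHitW n w S ≤ γ * PrW n w + (+ 1 / n ℕ.^ n) * ι (atLeast k)
  PrHitW≤ w w∈[0,1] {γ} k 0≤γ ι[k-1]≤γn = begin
    PrHitW n w S
      ≤⟨ ∑-mono-≤ FN pointwise ⟩
    ℚΣ.∑ FN (λ f → γ * (u * w f) + u * 𝟙 (does (k ℕ.≤? hitCount f)))
      ≡⟨ ℚΣ.∑-distrib-+ FN (λ f → γ * (u * w f)) (λ f → u * 𝟙 (does (k ℕ.≤? hitCount f))) ⟩
    ℚΣ.∑ FN (λ f → γ * (u * w f)) + ℚΣ.∑ FN (λ f → u * 𝟙 (does (k ℕ.≤? hitCount f)))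
      ≡⟨ cong₂ _+_ (sym (ℚΣ.*-distribˡ-∑ FN γ _))
                   (trans (sym (ℚΣ.*-distribˡ-∑ FN u _)) (cong (u *_) (∑-𝟙 FN _))) ⟩
    γ * PrW n w + u * ι (atLeast k) ∎
    where
    open ≤-Reasoning
    FN = allFns n n
    u = + 1 / n ℕ.^ n
    v = + 1 / n
    pointwise : ∀ f → ℚΣ.∑ (allFin n) (λ y → u * w f * v * 𝟙 (hit y f))
                        ≤ γ * (u * w f) + u * 𝟙 (does (k ℕ.≤? hitCount f))
    pointwise f = begin
      ℚΣ.∑ (allFin n) (λ y → u * w f * v * 𝟙 (hit y f))  ≡⟨ ℚΣ.*-distribˡ-∑ (allFin n) (u * w f * v) _ ⟨
      u * w f * v * ℚΣ.∑ (allFin n) (λ y → 𝟙 (hit y f))  ≡⟨ cong (u * w f * v *_) (∑-𝟙 (allFin n) _) ⟩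
      u * w f * v * ι (hitCount f)                        ≡⟨ *-assoc (u * w f) v _ ⟩
      u * w f * (v * ι (hitCount f))                      ≤⟨ *-≤-threshold (k ℕ.≤? hitCount f) 0≤uw uw≤u 0≤γ
                                                              (1/*ι≤1 n (hitCount≤n f)) few-hits ⟩
      γ * (u * w f) + u * 𝟙 (does (k ℕ.≤? hitCount f))   ∎
      where
      0≤uw : 0ℚ ≤ u * w f
      0≤uw = 0≤-* (0≤/ 1 (n ℕ.^ n)) (proj₁ (w∈[0,1] f))
      uw≤u : u * w f ≤ u
      uw≤u = ≤-trans (*-monoˡ-≤-0≤ (0≤/ 1 (n ℕ.^ n)) (proj₂ (w∈[0,1] f))) (≤-reflexive (*-identityʳ u))
      few-hits : ¬ k ℕ.≤ hitCount f → v * ι (hitCount f) ≤ γ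
      few-hits k≰ = 1/*ι≤ {hitCount f} n (≤-trans (/-mono-≤ (hitCount f) (k ∸ 1) 1 1
                      (ℕ.*-monoˡ-≤ 1 (ℕ.∸-monoˡ-≤ 1 (ℕ.≰⇒> k≰)))) ι[k-1]≤γn)

  Pr[atLeast]≤ : ∀ {c} → (∀ y → ∣ S y ∣ ℕ.≤ c) → ∀ k →
                 (+ 1 / n ℕ.^ n) * ι (atLeast k) ≤ ι (n C k) * (+ c / n) ^ℚ k
  Pr[atLeast]≤ {c} |S|≤c k = begin
    (+ 1 / n ℕ.^ n) * ι (atLeast k)         ≡⟨ *-comm (+ 1 / n ℕ.^ n) (ι (atLeast k)) ⟩
    ι (atLeast k) * (+ 1 / n ℕ.^ n)         ≡⟨ ι*/≡/ (atLeast k) 1 (n ℕ.^ n) ⟩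
    + (atLeast k ℕ.* 1) / n ℕ.^ n           ≤⟨ /-mono-≤ (atLeast k ℕ.* 1) ((n C k) ℕ.* c ℕ.^ k) (n ℕ.^ n) (n ℕ.^ k)
                                                         counted ⟩
    + ((n C k) ℕ.* c ℕ.^ k) / n ℕ.^ k       ≡⟨ ι*/≡/ (n C k) (c ℕ.^ k) (n ℕ.^ k) ⟨
    ι (n C k) * (+ (c ℕ.^ k) / n ℕ.^ k)     ≡⟨ cong (ι (n C k) *_) (/-^ℚ c n k) ⟨
    ι (n C k) * (+ c / n) ^ℚ k              ∎
    where
    open ≤-Reasoning
    instance nᵏ≢0 = ℕ.m^n≢0 n k
    counted : atLeast k ℕ.* 1 ℕ.* n ℕ.^ k ℕ.≤ (n C k) ℕ.* c ℕ.^ k ℕ.* n ℕ.^ n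
    counted = subst (ℕ._≤ (n C k) ℕ.* c ℕ.^ k ℕ.* n ℕ.^ n) (cong (ℕ._* n ℕ.^ k) (sym (ℕ.*-identityʳ (atLeast k))))
                    (atLeast-bound |S|≤c k)

  ι[nCk]≤ : ∀ {γ} k (0<γ : 0ℚ < γ) → γ ≤ + 1 / 2 → γ * ι n ≤ ι k →
            ι (n C k) ≤ ((1/ γ) {{>-nonZero 0<γ}}) ^ℚ (2 ℕ.* k)
  ι[nCk]≤ {γ} k 0<γ γ≤½ γn≤k = ≤[1/γ]^ℚ (2 ℕ.* k) 0<γ (estimate (2 ℕ.* k ℕ.≤? n))
    where
    estimate : Dec (2 ℕ.* k ℕ.≤ n) → ι (n C k) * γ ^ℚ (2 ℕ.* k) ≤ 1ℚ
    estimate (yes 2k≤n) =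
      ι*^ℚ≤1 (n C k) k n (2 ℕ.* k) (nCk*k^[2k]≤n^[2k] n k 2k≤n) (<⇒≤ 0<γ) (*ι≤ι⇒≤/ {k} n γn≤k)
    estimate (no 2k≰n)  = ι*^ℚ≤1 (n C k) 1 2 (2 ℕ.* k) nCk≤2^2k (<⇒≤ 0<γ) γ≤½
      where
      nCk≤2^2k : (n C k) ℕ.* 1 ℕ.^ (2 ℕ.* k) ℕ.≤ 2 ℕ.^ (2 ℕ.* k)
      nCk≤2^2k = ℕ.≤-trans (ℕ.≤-reflexive (trans (cong ((n C k) ℕ.*_) (ℕ.^-zeroˡ (2 ℕ.* k))) (ℕ.*-identityʳ _)))
                   (ℕ.≤-trans (nCk≤2^n n k) (ℕ.^-monoʳ-≤ 2 (ℕ.<⇒≤ (ℕ.≰⇒> 2k≰n))))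

claim3p6 : (n : ℕ) .{{_ : NonZero n}}
    → (w : (Fin n → Fin n) → ℚ) → IsCondProb w
    → (p : ℚ) → (p>0 : 0ℚ < p) → (pW : p ≤ PrW n w)
    → (c : ℕ) → (S : Fin n → Subset n) → (∀ i → ∣ S i ∣ ≡ c)
    → (γ : ℚ) → (γ>0 : 0ℚ < γ) → γ ≤ (+ 1) / 2
    → PrHit∣W n w S (PrW-pos n w p p>0 pW) ≤ bound n c γ p γ>0 p>0
claim3p6 n w w∈[0,1] p p>0 p≤PrW c S |S|≡c γ γ>0 γ≤½ = ÷-≤ {γ = γ} {T = T} p>0 p≤PrW 0≤T joint
  where
  instance nⁿ≢0 = ℕ.m^n≢0 n n
  γn = γ * ι n
  k = ℤ.∣ ceiling γn ∣
  0<γn : 0ℚ < γn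
  0<γn = positive⁻¹ γn {{pos*pos⇒pos γ {{positive γ>0}} (ι n) {{normalize-pos n 1}}}}
  γn≤k : γn ≤ ι k
  γn≤k = proj₁ (ceiling-bounds γn 0<γn)
  ι[k-1]≤γn : ι (k ∸ 1) ≤ γn
  ι[k-1]≤γn = proj₂ (ceiling-bounds γn 0<γn)
  T : ℚ
  T = ((1/ γ) {{>-nonZero γ>0}}) ^ℚ (2 ℕ.* k) * (+ c / n) ^ℚ k
  0≤T : 0ℚ ≤ T
  0≤T = 0≤-* (0≤^ℚ (2 ℕ.* k) (0≤1/ γ>0)) (0≤^ℚ k (0≤/ c n))
  Pr[atLeast-k]≤T : (+ 1 / n ℕ.^ n) * ι (Hits.atLeast n S k) ≤ T
  Pr[atLeast-k]≤T = ≤-trans (Pr[atLeast]≤ n S (λ y → ℕ.≤-reflexive (|S|≡c y)) k)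
                            (*-monoʳ-≤-0≤ (0≤^ℚ k (0≤/ c n)) (ι[nCk]≤ n S k γ>0 γ≤½ γn≤k))
  joint : PrHitW n w S ≤ γ * PrW n w + T
  joint = ≤-trans (PrHitW≤ n S w w∈[0,1] k (<⇒≤ γ>0) ι[k-1]≤γn) (+-monoʳ-≤ (γ * PrW n w) Pr[atLeast-k]≤T)
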